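{- Let $\lambda$ be a nonzero real number. Define the degenerate Bell numbers of the second kind $\mathrm{bel}_{n,\lambda}$ ($n\ge1$) by \[ \log_{\lambda}\big(1+\log_{\lambda}(1+t)\big)=\sum_{n=1}^{\infty}\mathrm{bel}_{n,\lambda}\frac{t^{n}}{n!}. \] Then $\mathrm{bel}_{1,\lambda}=1$, and for every $n\ge2$, \[ \sum_{j=1}^{n}\sum_{k=1}^{j}\mathrm{bel}_{k,\lambda}S_{2,\lambda}(j,k)S_{2,\lambda}(n,j)=0. \]
   Context: For real $x$ and $\mu$, $(x)_{0,\mu}=1$ and $(x)_{n,\mu}=x(x-\mu)\cdots(x-(n-1)\mu)$ for $n\ge1$. The degenerate exponential is $e_\lambda(t)=\sum_{n\ge0}(1)_{n,\lambda}\frac{t^n}{n!}$ (i.e. $(1+\lambda t)^{1/\lambda}$), and the degenerate logarithm is $\log_{\lambda}(1+t)=\sum_{n=1}^{\infty}\lambda^{n-1}(1)_{n,1/\lambda}\frac{t^{n}}{n!}$ (i.e. $\frac1\lambda((1+t)^\lambda-1)$). The degenerate Stirling numbers of the second kind are defined by $\frac{1}{k!}\big(e_{\lambda}(t)-1\big)^{k}=\sum_{n=k}^{\infty}S_{2,\lambda}(n,k)\frac{t^{n}}{n!}$. All series are formal power series. -}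

module Defs where

open import Level using (Level)
open import Data.Nat using (ℕ; zero; suc; _∸_; _!)
open import Algebra.Bundles using (CommutativeRing)

natR : {c ℓ : Level} (R : CommutativeRing c ℓ) → ℕ → CommutativeRing.Carrier R
natR R zero = CommutativeRing.0# R
natR R (suc n) = CommutativeRing._+_ R (CommutativeRing.1# R) (natR R n)

-- All definitions are relative to a commutative ring R (the reals in the
-- paper), a function inv with  (1+i)·1 * inv i ≈ 1  (inverses of positive
-- integers), and λ together with an inverse λ⁻¹ (λ nonzero).
module Degenerate {c ℓ : Level} (R : CommutativeRing c ℓ)
                  (inv : ℕ → CommutativeRing.Carrier R)
                  (lam lam⁻¹ : CommutativeRing.Carrier R) where
  open CommutativeRing R

  nat : ℕ → Carrier
  nat = natR R

  sumTo : ℕ → (ℕ → Carrier) → Carrier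
  sumTo zero f = f 0
  sumTo (suc n) f = sumTo n f + f (suc n)

  sum1 : ℕ → (ℕ → Carrier) → Carrier
  sum1 zero f = 0#
  sum1 (suc n) f = sum1 n f + f (suc n)

  prodLt : ℕ → (ℕ → Carrier) → Carrier
  prodLt zero f = 1#
  prodLt (suc n) f = prodLt n f * f n

  pw : Carrier → ℕ → Carrier
  pw x zero = 1#
  pw x (suc n) = pw x n * x

  invFact : ℕ → Carrier
  invFact n = prodLt n inv

  falling : Carrier → Carrier → ℕ → Carrier
  falling x μ n = prodLt n (λ i → x - nat i * μ)

  -- formal power series, by ordinary coefficients: f ↦ Σ f n tⁿ
  Series : Set c
  Series = ℕ → Carrier

  mul : Series → Series → Series
  mul f g n = sumTo n (λ k → f k * g (n ∸ k))

  pow : Series → ℕ → Series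
  pow g zero zero = 1#
  pow g zero (suc n) = 0#
  pow g (suc k) = mul (pow g k) g

  -- composition f(g(t)), for g with zero constant term
  compose : Series → Series → Series
  compose f g n = sumTo n (λ k → f k * pow g k n)

  -- log_λ(1+t) = Σ_{n≥1} λ^{n-1} (1)_{n,1/λ} tⁿ/n!
  logλ : Series
  logλ zero = 0#
  logλ (suc m) = pw lam m * falling 1# lam⁻¹ (suc m) * invFact (suc m)

  -- e_λ(t) - 1 = Σ_{n≥1} (1)_{n,λ} tⁿ/n!
  eλm1 : Series
  eλm1 zero = 0#
  eλm1 (suc m) = falling 1# lam (suc m) * invFact (suc m)

  bel : ℕ → Carrier
  bel n = nat (n !) * compose logλ logλ n

  -- degenerate Stirling numbers of the second kind:
  -- (1/k!)(e_λ(t)-1)^k = Σ S_{2,λ}(n,k) tⁿ/n!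
  S2 : ℕ → ℕ → Carrier
  S2 n k = nat (n !) * (invFact k * pow eλm1 k n)

-- Write E = e_λ(t) - 1 and L = log_λ(1+t), and let Dλ = (1 + λt) d/dt.  Both
-- series solve first-order equations, Dλ E = 1 + E and (1+t) L' = 1 + λL, and
-- the chain rule for Dλ turns them into Dλ (L∘E) = 1 + λ (L∘E), whose only
-- solution without constant term is t.  Hence L∘E = t, so
-- (L∘L)∘E = L∘(L∘E) = L.  Taking coefficients, Σ_k k! g_k S_{2,λ}(j,k) is
-- j! times the j-th coefficient of g∘E; applied to g = L∘L this gives
-- Σ_k bel_{k,λ} S_{2,λ}(j,k) = j! L_j, and applied again to g = L it turns the
-- double sum into n! times the n-th coefficient of L∘E = t.
module Submission where

open import Defs
open import Level using (Level)
open import Data.Nat using (ℕ; zero; suc; _≤_; _<_; _≤′_; _∸_; _!; z≤n; s≤s)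
import Data.Nat as ℕ
import Data.Nat.Properties as ℕₚ
open import Data.Product using (_×_; _,_)
open import Data.Sum using (inj₁; inj₂)
open import Algebra.Bundles using (CommutativeRing)
import Algebra.Properties.Ring as RingProperties
import Algebra.Properties.CommutativeSemigroup as CommutativeSemigroupProperties
import Algebra.Solver.Ring.NaturalCoefficients.Default as NaturalSolver
open import Relation.Binary.PropositionalEquality as ≡ using (_≡_)

module FormalSeries {c ℓ : Level} (R : CommutativeRing c ℓ)
                    (inv : ℕ → CommutativeRing.Carrier R)
                    (lam lam⁻¹ : CommutativeRing.Carrier R) where
  open CommutativeRing R hiding (zero)
  open Degenerate R inv lam lam⁻¹
  open RingProperties ring using (-0#≈0#)
  open CommutativeSemigroupProperties +-commutativeSemigroup using () renaming (interchange to +-interchange)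
  open NaturalSolver commutativeSemiring using (solve; _:*_; _:+_; _:=_)
  open import Relation.Binary.Reasoning.Setoid setoid

  nat-homo-+ : ∀ m n → nat (m ℕ.+ n) ≈ nat m + nat n
  nat-homo-+ zero    n = sym (+-identityˡ _)
  nat-homo-+ (suc m) n = trans (+-congˡ (nat-homo-+ m n)) (sym (+-assoc _ _ _))

  nat-homo-* : ∀ m n → nat (m ℕ.* n) ≈ nat m * nat n
  nat-homo-* zero    n = sym (zeroˡ _)
  nat-homo-* (suc m) n = begin
    nat (n ℕ.+ m ℕ.* n)        ≈⟨ nat-homo-+ n (m ℕ.* n) ⟩
    nat n + nat (m ℕ.* n)      ≈⟨ +-cong (sym (*-identityˡ _)) (nat-homo-* m n) ⟩
    1# * nat n + nat m * nat n ≈⟨ distribʳ _ _ _ ⟨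
    (1# + nat m) * nat n       ∎

  nat-1 : nat 1 ≈ 1#
  nat-1 = +-identityʳ 1#

  1-0*x≈1 : ∀ x → 1# - 0# * x ≈ 1#
  1-0*x≈1 x = trans (+-congˡ (trans (-‿cong (zeroˡ x)) -0#≈0#)) (+-identityʳ 1#)

  x[1-y]+xy≈x : ∀ x y → x * (1# - y) + x * y ≈ x
  x[1-y]+xy≈x x y = begin
    x * (1# - y) + x * y ≈⟨ distribˡ x _ y ⟨
    x * (1# - y + y)     ≈⟨ *-congˡ (+-assoc 1# (- y) y) ⟩
    x * (1# + (- y + y)) ≈⟨ *-congˡ (+-congˡ (-‿inverseˡ y)) ⟩
    x * (1# + 0#)        ≈⟨ *-congˡ (+-identityʳ 1#) ⟩
    x * 1#               ≈⟨ *-identityʳ x ⟩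
    x                    ∎

  sumTo-cong-≤ : ∀ n {f g : ℕ → Carrier} → (∀ i → i ≤ n → f i ≈ g i) → sumTo n f ≈ sumTo n g
  sumTo-cong-≤ zero    f≈g = f≈g 0 z≤n
  sumTo-cong-≤ (suc n) f≈g =
    +-cong (sumTo-cong-≤ n (λ i i≤n → f≈g i (ℕₚ.m≤n⇒m≤1+n i≤n))) (f≈g (suc n) ℕₚ.≤-refl)

  sumTo-cong : ∀ n {f g : ℕ → Carrier} → (∀ i → f i ≈ g i) → sumTo n f ≈ sumTo n g
  sumTo-cong n f≈g = sumTo-cong-≤ n (λ i _ → f≈g i)

  sumTo-≈0 : ∀ n {f : ℕ → Carrier} → (∀ i → i ≤ n → f i ≈ 0#) → sumTo n f ≈ 0#
  sumTo-≈0 n f≈0 = trans (sumTo-cong-≤ n f≈0) (all-0 n)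
    where
    all-0 : ∀ n → sumTo n (λ _ → 0#) ≈ 0#
    all-0 zero    = refl
    all-0 (suc n) = trans (+-identityʳ _) (all-0 n)

  sumTo-distrib-+ : ∀ n (f g : ℕ → Carrier) → sumTo n (λ i → f i + g i) ≈ sumTo n f + sumTo n g
  sumTo-distrib-+ zero    f g = refl
  sumTo-distrib-+ (suc n) f g = trans (+-congʳ (sumTo-distrib-+ n f g)) (+-interchange _ _ _ _)

  *-distribˡ-sumTo : ∀ n x (f : ℕ → Carrier) → x * sumTo n f ≈ sumTo n (λ i → x * f i)
  *-distribˡ-sumTo zero    x f = refl
  *-distribˡ-sumTo (suc n) x f = trans (distribˡ _ _ _) (+-congʳ (*-distribˡ-sumTo n x f))

  *-distribʳ-sumTo : ∀ n x (f : ℕ → Carrier) → sumTo n f * x ≈ sumTo n (λ i → f i * x)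
  *-distribʳ-sumTo zero    x f = refl
  *-distribʳ-sumTo (suc n) x f = trans (distribʳ _ _ _) (+-congʳ (*-distribʳ-sumTo n x f))

  sumTo-*-sumTo : ∀ m n (f g : ℕ → Carrier) →
                  sumTo m f * sumTo n g ≈ sumTo m (λ i → sumTo n (λ j → f i * g j))
  sumTo-*-sumTo m n f g =
    trans (*-distribʳ-sumTo m _ f) (sumTo-cong m (λ i → *-distribˡ-sumTo n (f i) g))

  sumTo-extend : ∀ {m n} (f : ℕ → Carrier) → m ≤ n → (∀ i → m < i → f i ≈ 0#) → sumTo n f ≈ sumTo m f
  sumTo-extend {m} f m≤n tail = extend (ℕₚ.≤⇒≤′ m≤n)
    where
    extend : ∀ {n} → m ≤′ n → sumTo n f ≈ sumTo m f
    extend ℕ.≤′-refl        = refl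
    extend (ℕ.≤′-step m≤′n) =
      trans (+-cong (extend m≤′n) (tail _ (s≤s (ℕₚ.≤′⇒≤ m≤′n)))) (+-identityʳ _)

  sumTo-suc : ∀ n (f : ℕ → Carrier) → sumTo (suc n) f ≈ f 0 + sumTo n (λ i → f (suc i))
  sumTo-suc zero    f = refl
  sumTo-suc (suc n) f = trans (+-congʳ (sumTo-suc n f)) (+-assoc _ _ _)

  sumTo-shift : ∀ n (f : ℕ → Carrier) → f 0 ≈ 0# → f (suc n) ≈ 0# →
                sumTo n (λ i → f (suc i)) ≈ sumTo n f
  sumTo-shift n f f0≈0 fn≈0 = begin
    sumTo n (λ i → f (suc i))       ≈⟨ +-identityˡ _ ⟨
    0# + sumTo n (λ i → f (suc i))  ≈⟨ +-congʳ f0≈0 ⟨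
    f 0 + sumTo n (λ i → f (suc i)) ≈⟨ sumTo-suc n f ⟨
    sumTo n f + f (suc n)           ≈⟨ +-congˡ fn≈0 ⟩
    sumTo n f + 0#                  ≈⟨ +-identityʳ _ ⟩
    sumTo n f                       ∎

  sumTo-comm : ∀ m n (f : ℕ → ℕ → Carrier) →
               sumTo m (λ i → sumTo n (f i)) ≈ sumTo n (λ j → sumTo m (λ i → f i j))
  sumTo-comm zero    n f = refl
  sumTo-comm (suc m) n f =
    trans (+-congʳ (sumTo-comm m n f)) (sym (sumTo-distrib-+ n _ (f (suc m))))

  sumTo-reverse : ∀ n (f : ℕ → Carrier) → sumTo n f ≈ sumTo n (λ i → f (n ∸ i))
  sumTo-reverse zero    f = refl
  sumTo-reverse (suc n) f = begin
    sumTo n f + f (suc n)                 ≈⟨ +-comm _ _ ⟩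
    f (suc n) + sumTo n f                 ≈⟨ +-congˡ (sumTo-reverse n f) ⟩
    f (suc n) + sumTo n (λ i → f (n ∸ i)) ≈⟨ sumTo-suc n (λ i → f (suc n ∸ i)) ⟨
    sumTo (suc n) (λ i → f (suc n ∸ i))   ∎

  sumTo-triangle : ∀ n (f : ℕ → ℕ → Carrier) →
    sumTo n (λ m → sumTo m (λ i → f i (m ∸ i))) ≈ sumTo n (λ i → sumTo (n ∸ i) (f i))
  sumTo-triangle zero    f = refl
  sumTo-triangle (suc n) f = begin
    sumTo n (λ m → sumTo m (λ i → f i (m ∸ i))) + sumTo (suc n) (λ i → f i (suc n ∸ i))
      ≈⟨ +-cong (sumTo-triangle n f) (+-cong (sumTo-cong-≤ n (λ i i≤n → ≈-f i (suc-∸ i≤n))) (≈-f (suc n) (ℕₚ.n∸n≡0 n))) ⟩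
    sumTo n (λ i → sumTo (n ∸ i) (f i)) + (sumTo n (λ i → f i (suc (n ∸ i))) + f (suc n) 0)
      ≈⟨ +-assoc _ _ _ ⟨
    (sumTo n (λ i → sumTo (n ∸ i) (f i)) + sumTo n (λ i → f i (suc (n ∸ i)))) + f (suc n) 0
      ≈⟨ +-congʳ (sumTo-distrib-+ n _ _) ⟨
    sumTo n (λ i → sumTo (suc (n ∸ i)) (f i)) + f (suc n) 0
      ≈⟨ +-cong (sumTo-cong-≤ n (λ i i≤n → ≈-sumTo (f i) (≡.sym (suc-∸ i≤n)))) (≈-sumTo (f (suc n)) (≡.sym (ℕₚ.n∸n≡0 n))) ⟩
    sumTo n (λ i → sumTo (suc n ∸ i) (f i)) + sumTo (suc n ∸ suc n) (f (suc n))
      ∎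
    where
    suc-∸ : ∀ {i} → i ≤ n → suc n ∸ i ≡ suc (n ∸ i)
    suc-∸ = ℕₚ.+-∸-assoc 1
    ≈-f : ∀ i {j k} → j ≡ k → f i j ≈ f i k
    ≈-f i j≡k = reflexive (≡.cong (f i) j≡k)
    ≈-sumTo : ∀ g {j k} → j ≡ k → sumTo j g ≈ sumTo k g
    ≈-sumTo g j≡k = reflexive (≡.cong (λ m → sumTo m g) j≡k)

  sum1-cong : ∀ n {f g : ℕ → Carrier} → (∀ i → f i ≈ g i) → sum1 n f ≈ sum1 n g
  sum1-cong zero    f≈g = refl
  sum1-cong (suc n) f≈g = +-cong (sum1-cong n f≈g) (f≈g (suc n))

  *-distribʳ-sum1 : ∀ n x (f : ℕ → Carrier) → sum1 n f * x ≈ sum1 n (λ i → f i * x)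
  *-distribʳ-sum1 zero    x f = zeroˡ x
  *-distribʳ-sum1 (suc n) x f = trans (distribʳ _ _ _) (+-congʳ (*-distribʳ-sum1 n x f))

  sum1≈sumTo : ∀ n (f : ℕ → Carrier) → f 0 ≈ 0# → sum1 n f ≈ sumTo n f
  sum1≈sumTo zero    f f0≈0 = sym f0≈0
  sum1≈sumTo (suc n) f f0≈0 = +-congʳ (sum1≈sumTo n f f0≈0)

  infix  4 _≋_
  infixl 6 _+ₛ_
  infixr 7 _·ₛ_

  _≋_ : Series → Series → Set ℓ
  f ≋ g = ∀ n → f n ≈ g n

  δ : ℕ → Series
  δ zero    zero    = 1#
  δ zero    (suc n) = 0#
  δ (suc k) zero    = 0#
  δ (suc k) (suc n) = δ k n

  1ₛ : Series
  1ₛ = δ 0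

  X : Series
  X = δ 1

  _+ₛ_ : Series → Series → Series
  (f +ₛ g) n = f n + g n

  _·ₛ_ : Carrier → Series → Series
  (x ·ₛ f) n = x * f n

  δ-diag : ∀ n → δ n n ≡ 1#
  δ-diag zero    = ≡.refl
  δ-diag (suc n) = δ-diag n

  δ-< : ∀ {k n} → k < n → δ k n ≡ 0#
  δ-< {zero}  {suc n} _         = ≡.refl
  δ-< {suc k} {suc n} (s≤s k<n) = δ-< k<n

  pow-zero : ∀ g n → pow g 0 n ≡ 1ₛ n
  pow-zero g zero    = ≡.refl
  pow-zero g (suc n) = ≡.refl

  mul-cong : ∀ {f f′ g g′} → f ≋ f′ → g ≋ g′ → mul f g ≋ mul f′ g′
  mul-cong f≋f′ g≋g′ n = sumTo-cong n (λ k → *-cong (f≋f′ k) (g≋g′ (n ∸ k)))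

  mul-congˡ : ∀ {f f′} g → f ≋ f′ → mul f g ≋ mul f′ g
  mul-congˡ g f≋f′ = mul-cong {g = g} {g′ = g} f≋f′ (λ _ → refl)

  mul-congʳ : ∀ f {g g′} → g ≋ g′ → mul f g ≋ mul f g′
  mul-congʳ f = mul-cong {f = f} {f′ = f} (λ _ → refl)

  mul-comm : ∀ f g → mul f g ≋ mul g f
  mul-comm f g n = begin
    sumTo n (λ k → f k * g (n ∸ k))             ≈⟨ sumTo-reverse n _ ⟩
    sumTo n (λ k → f (n ∸ k) * g (n ∸ (n ∸ k))) ≈⟨ sumTo-cong-≤ n swap ⟩
    sumTo n (λ k → g k * f (n ∸ k))             ∎
    where
    swap : ∀ k → k ≤ n → f (n ∸ k) * g (n ∸ (n ∸ k)) ≈ g k * f (n ∸ k)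
    swap k k≤n = trans (*-comm _ _) (*-congʳ (reflexive (≡.cong g (ℕₚ.m∸[m∸n]≡n k≤n))))

  mul-assoc : ∀ f g h → mul (mul f g) h ≋ mul f (mul g h)
  mul-assoc f g h n = begin
    sumTo n (λ m → sumTo m (λ i → f i * g (m ∸ i)) * h (n ∸ m))
      ≈⟨ sumTo-cong n (λ m → *-distribʳ-sumTo m _ _) ⟩
    sumTo n (λ m → sumTo m (λ i → f i * g (m ∸ i) * h (n ∸ m)))
      ≈⟨ sumTo-cong n (λ m → sumTo-cong-≤ m (λ i i≤m → *-congˡ (≈-h (≡.cong (n ∸_) (≡.sym (ℕₚ.m+[n∸m]≡n i≤m)))))) ⟩
    sumTo n (λ m → sumTo m (λ i → f i * g (m ∸ i) * h (n ∸ (i ℕ.+ (m ∸ i)))))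
      ≈⟨ sumTo-triangle n (λ i j → f i * g j * h (n ∸ (i ℕ.+ j))) ⟩
    sumTo n (λ i → sumTo (n ∸ i) (λ j → f i * g j * h (n ∸ (i ℕ.+ j))))
      ≈⟨ sumTo-cong n (λ i → sumTo-cong (n ∸ i) (λ j → trans (*-assoc _ _ _) (*-congˡ (*-congˡ (≈-h (≡.sym (ℕₚ.∸-+-assoc n i j))))))) ⟩
    sumTo n (λ i → sumTo (n ∸ i) (λ j → f i * (g j * h (n ∸ i ∸ j))))
      ≈⟨ sumTo-cong n (λ i → *-distribˡ-sumTo (n ∸ i) _ _) ⟨
    sumTo n (λ i → f i * sumTo (n ∸ i) (λ j → g j * h (n ∸ i ∸ j)))
      ∎
    where
    ≈-h : ∀ {j k} → j ≡ k → h j ≈ h k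
    ≈-h j≡k = reflexive (≡.cong h j≡k)

  mul-identityˡ : ∀ f → mul 1ₛ f ≋ f
  mul-identityˡ f zero    = *-identityˡ _
  mul-identityˡ f (suc n) = begin
    sumTo (suc n) (λ k → 1ₛ k * f (suc n ∸ k))       ≈⟨ sumTo-suc n _ ⟩
    1# * f (suc n) + sumTo n (λ k → 0# * f (n ∸ k)) ≈⟨ +-cong (*-identityˡ _) (sumTo-≈0 n (λ _ _ → zeroˡ _)) ⟩
    f (suc n) + 0#                                  ≈⟨ +-identityʳ _ ⟩
    f (suc n)                                       ∎

  mul-identityʳ : ∀ f → mul f 1ₛ ≋ f
  mul-identityʳ f n = trans (mul-comm f 1ₛ n) (mul-identityˡ f n)

  mul-distribʳ-+ₛ : ∀ h f g → mul (f +ₛ g) h ≋ mul f h +ₛ mul g h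
  mul-distribʳ-+ₛ h f g n = trans (sumTo-cong n (λ k → distribʳ _ _ _)) (sumTo-distrib-+ n _ _)

  mul-distribˡ-+ₛ : ∀ h f g → mul h (f +ₛ g) ≋ mul h f +ₛ mul h g
  mul-distribˡ-+ₛ h f g n = trans (sumTo-cong n (λ k → distribˡ _ _ _)) (sumTo-distrib-+ n _ _)

  mul-·ₛˡ : ∀ x f g → mul (x ·ₛ f) g ≋ x ·ₛ mul f g
  mul-·ₛˡ x f g n = trans (sumTo-cong n (λ k → *-assoc _ _ _)) (sym (*-distribˡ-sumTo n x _))

  mul-·ₛʳ : ∀ x f g → mul f (x ·ₛ g) ≋ x ·ₛ mul f g
  mul-·ₛʳ x f g n = trans (sumTo-cong n (λ k → x*[y*z]≈y*[x*z] _ _ _)) (sym (*-distribˡ-sumTo n x _))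
    where
    x*[y*z]≈y*[x*z] : ∀ a b c → a * (b * c) ≈ b * (a * c)
    x*[y*z]≈y*[x*z] = solve 3 (λ a b c → a :* (b :* c) := b :* (a :* c)) refl

  mul-X : ∀ f n → mul f X (suc n) ≈ f n
  mul-X f n = begin
    mul f X (suc n)                            ≈⟨ mul-comm f X (suc n) ⟩
    sumTo (suc n) (λ k → X k * f (suc n ∸ k))  ≈⟨ sumTo-suc n _ ⟩
    0# * f (suc n) + sumTo n (λ k → δ 0 k * f (n ∸ k)) ≈⟨ trans (+-congʳ (zeroˡ _)) (+-identityˡ _) ⟩
    mul 1ₛ f n                                 ≈⟨ mul-identityˡ f n ⟩
    f n                                        ∎

  pow-cong : ∀ {g h} → g ≋ h → ∀ k → pow g k ≋ pow h k
  pow-cong g≋h zero    n = reflexive (≡.trans (pow-zero _ n) (≡.sym (pow-zero _ n)))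
  pow-cong g≋h (suc k)   = mul-cong (pow-cong g≋h k) g≋h

  pow-identityʳ : ∀ g → pow g 1 ≋ g
  pow-identityʳ g n = trans (mul-congˡ g (λ m → reflexive (pow-zero g m)) n) (mul-identityˡ g n)

  pow-+ : ∀ g i j → pow g (i ℕ.+ j) ≋ mul (pow g i) (pow g j)
  pow-+ g i zero    n = begin
    pow g (i ℕ.+ 0) n        ≈⟨ reflexive (≡.cong (λ k → pow g k n) (ℕₚ.+-identityʳ i)) ⟩
    pow g i n                ≈⟨ mul-identityʳ (pow g i) n ⟨
    mul (pow g i) 1ₛ n       ≈⟨ mul-congʳ (pow g i) (λ m → reflexive (≡.sym (pow-zero g m))) n ⟩
    mul (pow g i) (pow g 0) n ∎
  pow-+ g i (suc j) n = begin
    pow g (i ℕ.+ suc j) n               ≈⟨ reflexive (≡.cong (λ k → pow g k n) (ℕₚ.+-suc i j)) ⟩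
    mul (pow g (i ℕ.+ j)) g n           ≈⟨ mul-congˡ g (pow-+ g i j) n ⟩
    mul (mul (pow g i) (pow g j)) g n   ≈⟨ mul-assoc _ _ g n ⟩
    mul (pow g i) (pow g (suc j)) n     ∎

  pow-vanishes : ∀ g → g 0 ≈ 0# → ∀ k n → n < k → pow g k n ≈ 0#
  pow-vanishes g g0≈0 (suc k) n (s≤s n≤k) = sumTo-≈0 n term≈0
    where
    term≈0 : ∀ i → i ≤ n → pow g k i * g (n ∸ i) ≈ 0#
    term≈0 i i≤n with ℕₚ.m≤n⇒m<n∨m≡n (ℕₚ.≤-trans i≤n n≤k)
    ... | inj₁ i<k    = trans (*-congʳ (pow-vanishes g g0≈0 k i i<k)) (zeroˡ _)
    ... | inj₂ ≡.refl with ℕₚ.≤-antisym i≤n n≤k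
    ...   | ≡.refl    = trans (*-congˡ (trans (reflexive (≡.cong g (ℕₚ.n∸n≡0 n))) g0≈0)) (zeroʳ _)

  pow-X : ∀ k → pow X k ≋ δ k
  pow-X zero    n       = reflexive (pow-zero X n)
  pow-X (suc k) zero    = zeroʳ _
  pow-X (suc k) (suc n) = trans (mul-X (pow X k) n) (pow-X k n)

  compose-congˡ : ∀ {f f′} h → f ≋ f′ → compose f h ≋ compose f′ h
  compose-congˡ h f≋f′ n = sumTo-cong n (λ k → *-congʳ (f≋f′ k))

  compose-congʳ : ∀ f {h h′} → h ≋ h′ → compose f h ≋ compose f h′
  compose-congʳ f h≋h′ n = sumTo-cong n (λ k → *-congˡ (pow-cong h≋h′ k n))

  compose-extend : ∀ f h → h 0 ≈ 0# → ∀ {n m} → n ≤ m →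
                   compose f h n ≈ sumTo m (λ k → f k * pow h k n)
  compose-extend f h h0≈0 {n} n≤m =
    sym (sumTo-extend _ n≤m (λ k n<k → trans (*-congˡ (pow-vanishes h h0≈0 k n n<k)) (zeroʳ _)))

  compose-1ₛ : ∀ h → compose 1ₛ h ≋ 1ₛ
  compose-1ₛ h zero    = *-identityˡ _
  compose-1ₛ h (suc n) = begin
    sumTo (suc n) (λ k → 1ₛ k * pow h k (suc n))                       ≈⟨ sumTo-suc n _ ⟩
    1# * pow h 0 (suc n) + sumTo n (λ k → 0# * pow h (suc k) (suc n)) ≈⟨ +-cong (*-identityˡ _) (sumTo-≈0 n (λ _ _ → zeroˡ _)) ⟩
    0# + 0#                                                           ≈⟨ +-identityʳ 0# ⟩
    0#                                                                ∎

  compose-X : ∀ f → compose f X ≋ f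
  compose-X f n = begin
    sumTo n (λ k → f k * pow X k n) ≈⟨ sumTo-cong n (λ k → *-congˡ (pow-X k n)) ⟩
    sumTo n (λ k → f k * δ k n)     ≈⟨ diagonal n ⟩
    f n                             ∎
    where
    diagonal : ∀ n → sumTo n (λ k → f k * δ k n) ≈ f n
    diagonal zero    = *-identityʳ _
    diagonal (suc n) = begin
      sumTo n (λ k → f k * δ k (suc n)) + f (suc n) * δ n n
        ≈⟨ +-cong (sumTo-≈0 n (λ k k≤n → trans (*-congˡ (reflexive (δ-< (s≤s k≤n)))) (zeroʳ _)))
                  (trans (*-congˡ (reflexive (δ-diag n))) (*-identityʳ _)) ⟩
      0# + f (suc n) ≈⟨ +-identityˡ _ ⟩
      f (suc n)      ∎

  compose-+ₛ : ∀ h f g → compose (f +ₛ g) h ≋ compose f h +ₛ compose g h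
  compose-+ₛ h f g n = trans (sumTo-cong n (λ k → distribʳ _ _ _)) (sumTo-distrib-+ n _ _)

  compose-·ₛ : ∀ h x f → compose (x ·ₛ f) h ≋ x ·ₛ compose f h
  compose-·ₛ h x f n = trans (sumTo-cong n (λ k → *-assoc _ _ _)) (sym (*-distribˡ-sumTo n x _))

  compose-mul-square : ∀ f g h → h 0 ≈ 0# → ∀ n →
    compose (mul f g) h n ≈ sumTo n (λ i → sumTo n (λ j → f i * g j * pow h (i ℕ.+ j) n))
  compose-mul-square f g h h0≈0 n = begin
    sumTo n (λ m → sumTo m (λ i → f i * g (m ∸ i)) * pow h m n)
      ≈⟨ sumTo-cong n (λ m → *-distribʳ-sumTo m _ _) ⟩
    sumTo n (λ m → sumTo m (λ i → f i * g (m ∸ i) * pow h m n))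
      ≈⟨ sumTo-cong n (λ m → sumTo-cong-≤ m (λ i i≤m → *-congˡ (reflexive (≡.cong (λ k → pow h k n) (≡.sym (ℕₚ.m+[n∸m]≡n i≤m)))))) ⟩
    sumTo n (λ m → sumTo m (λ i → term i (m ∸ i)))
      ≈⟨ sumTo-triangle n term ⟩
    sumTo n (λ i → sumTo (n ∸ i) (term i))
      ≈⟨ sumTo-cong-≤ n (λ i i≤n → sym (sumTo-extend (term i) (ℕₚ.m∸n≤m n i) (term≈0 i≤n))) ⟩
    sumTo n (λ i → sumTo n (term i))
      ∎
    where
    term : ℕ → ℕ → Carrier
    term i j = f i * g j * pow h (i ℕ.+ j) n
    term≈0 : ∀ {i} → i ≤ n → ∀ j → n ∸ i < j → term i j ≈ 0#
    term≈0 {i} i≤n j n∸i<j = trans (*-congˡ (pow-vanishes h h0≈0 (i ℕ.+ j) n n<i+j)) (zeroʳ _)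
      where
      n<i+j : n < i ℕ.+ j
      n<i+j = ≡.subst (_< i ℕ.+ j) (ℕₚ.m+[n∸m]≡n i≤n) (ℕₚ.+-monoʳ-< i n∸i<j)

  compose-mul : ∀ f g h → h 0 ≈ 0# → compose (mul f g) h ≋ mul (compose f h) (compose g h)
  compose-mul f g h h0≈0 n = begin
    compose (mul f g) h n
      ≈⟨ compose-mul-square f g h h0≈0 n ⟩
    sumTo n (λ i → sumTo n (λ j → f i * g j * pow h (i ℕ.+ j) n))
      ≈⟨ sumTo-cong n (λ i → sumTo-cong n (λ j → *-congˡ (pow-+ h i j n))) ⟩
    sumTo n (λ i → sumTo n (λ j → f i * g j * sumTo n (λ p → pow h i p * pow h j (n ∸ p))))
      ≈⟨ sumTo-cong n (λ i → sumTo-cong n (λ j → trans (*-distribˡ-sumTo n _ _) (sumTo-cong n (λ p → interchange _ _ _ _)))) ⟩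
    sumTo n (λ i → sumTo n (λ j → sumTo n (λ p → f i * pow h i p * (g j * pow h j (n ∸ p)))))
      ≈⟨ sumTo-cong n (λ i → sumTo-comm n n _) ⟩
    sumTo n (λ i → sumTo n (λ p → sumTo n (λ j → f i * pow h i p * (g j * pow h j (n ∸ p)))))
      ≈⟨ sumTo-comm n n _ ⟩
    sumTo n (λ p → sumTo n (λ i → sumTo n (λ j → f i * pow h i p * (g j * pow h j (n ∸ p)))))
      ≈⟨ sumTo-cong n (λ p → sumTo-*-sumTo n n _ _) ⟨
    sumTo n (λ p → sumTo n (λ i → f i * pow h i p) * sumTo n (λ j → g j * pow h j (n ∸ p)))
      ≈⟨ sumTo-cong-≤ n (λ p p≤n → *-cong (compose-extend f h h0≈0 p≤n) (compose-extend g h h0≈0 (ℕₚ.m∸n≤m n p))) ⟨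
    mul (compose f h) (compose g h) n
      ∎
    where
    interchange : ∀ a b c d → a * b * (c * d) ≈ a * c * (b * d)
    interchange = solve 4 (λ a b c d → (a :* b) :* (c :* d) := (a :* c) :* (b :* d)) refl

  compose-pow : ∀ g h → h 0 ≈ 0# → ∀ k → compose (pow g k) h ≋ pow (compose g h) k
  compose-pow g h h0≈0 zero n = begin
    compose (pow g 0) h n ≈⟨ compose-congˡ h (λ m → reflexive (pow-zero g m)) n ⟩
    compose 1ₛ h n        ≈⟨ compose-1ₛ h n ⟩
    1ₛ n                  ≡⟨ pow-zero (compose g h) n ⟨
    pow (compose g h) 0 n ∎
  compose-pow g h h0≈0 (suc k) n =
    trans (compose-mul (pow g k) g h h0≈0 n) (mul-congˡ (compose g h) (compose-pow g h h0≈0 k) n)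

  compose-assoc : ∀ f g h → g 0 ≈ 0# → h 0 ≈ 0# → compose (compose f g) h ≋ compose f (compose g h)
  compose-assoc f g h g0≈0 h0≈0 n = begin
    sumTo n (λ j → compose f g j * pow h j n)
      ≈⟨ sumTo-cong-≤ n (λ j j≤n → *-congʳ (compose-extend f g g0≈0 j≤n)) ⟩
    sumTo n (λ j → sumTo n (λ k → f k * pow g k j) * pow h j n)
      ≈⟨ sumTo-cong n (λ j → trans (*-distribʳ-sumTo n _ _) (sumTo-cong n (λ k → *-assoc _ _ _))) ⟩
    sumTo n (λ j → sumTo n (λ k → f k * (pow g k j * pow h j n)))
      ≈⟨ sumTo-comm n n _ ⟩
    sumTo n (λ k → sumTo n (λ j → f k * (pow g k j * pow h j n)))
      ≈⟨ sumTo-cong n (λ k → *-distribˡ-sumTo n _ _) ⟨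
    sumTo n (λ k → f k * compose (pow g k) h n)
      ≈⟨ sumTo-cong n (λ k → *-congˡ (compose-pow g h h0≈0 k n)) ⟩
    compose f (compose g h) n
      ∎

  D : Series → Series
  D f n = nat (suc n) * f (suc n)

  tD : Series → Series
  tD f n = nat n * f n

  Dλ : Series → Series
  Dλ f = D f +ₛ lam ·ₛ tD f

  Dλ-cong : ∀ {f g} → f ≋ g → Dλ f ≋ Dλ g
  Dλ-cong f≋g n = +-cong (*-congˡ (f≋g (suc n))) (*-congˡ (*-congˡ (f≋g n)))

  Dλ-1ₛ : ∀ n → Dλ 1ₛ n ≈ 0#
  Dλ-1ₛ n = trans (+-cong (zeroʳ _) (trans (*-congˡ (tD-1ₛ n)) (zeroʳ lam))) (+-identityʳ 0#)
    where
    tD-1ₛ : ∀ n → tD 1ₛ n ≈ 0#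
    tD-1ₛ zero    = zeroˡ _
    tD-1ₛ (suc n) = zeroʳ _

  tD-leibniz : ∀ f g → tD (mul f g) ≋ mul (tD f) g +ₛ mul f (tD g)
  tD-leibniz f g n = begin
    nat n * sumTo n (λ i → f i * g (n ∸ i))
      ≈⟨ *-distribˡ-sumTo n _ _ ⟩
    sumTo n (λ i → nat n * (f i * g (n ∸ i)))
      ≈⟨ sumTo-cong-≤ n (λ i i≤n → *-congʳ (trans (reflexive (≡.cong nat (≡.sym (ℕₚ.m+[n∸m]≡n i≤n)))) (nat-homo-+ i (n ∸ i)))) ⟩
    sumTo n (λ i → (nat i + nat (n ∸ i)) * (f i * g (n ∸ i)))
      ≈⟨ sumTo-cong n (λ i → split _ _ _ _) ⟩
    sumTo n (λ i → nat i * f i * g (n ∸ i) + f i * (nat (n ∸ i) * g (n ∸ i)))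
      ≈⟨ sumTo-distrib-+ n _ _ ⟩
    mul (tD f) g n + mul f (tD g) n
      ∎
    where
    split : ∀ a b x y → (a + b) * (x * y) ≈ a * x * y + x * (b * y)
    split = solve 4 (λ a b x y → (a :+ b) :* (x :* y) := a :* x :* y :+ x :* (b :* y)) refl

  mul-Dˡ : ∀ f g n → mul (D f) g n ≈ mul (tD f) g (suc n)
  mul-Dˡ f g n = sym (begin
    sumTo (suc n) (λ k → tD f k * g (suc n ∸ k))            ≈⟨ sumTo-suc n _ ⟩
    0# * f 0 * g (suc n) + sumTo n (λ k → D f k * g (n ∸ k)) ≈⟨ +-congʳ (trans (*-congʳ (zeroˡ _)) (zeroˡ _)) ⟩
    0# + mul (D f) g n                                       ≈⟨ +-identityˡ _ ⟩
    mul (D f) g n                                            ∎)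

  mul-Dʳ : ∀ f g n → mul f (D g) n ≈ mul f (tD g) (suc n)
  mul-Dʳ f g n = trans (mul-comm f (D g) n) (trans (mul-Dˡ g f n) (mul-comm (tD g) f (suc n)))

  D-leibniz : ∀ f g → D (mul f g) ≋ mul (D f) g +ₛ mul f (D g)
  D-leibniz f g n = trans (tD-leibniz f g (suc n)) (sym (+-cong (mul-Dˡ f g n) (mul-Dʳ f g n)))

  Dλ-leibniz : ∀ f g → Dλ (mul f g) ≋ mul (Dλ f) g +ₛ mul f (Dλ g)
  Dλ-leibniz f g n = begin
    D (mul f g) n + lam * tD (mul f g) n
      ≈⟨ +-cong (D-leibniz f g n) (*-congˡ (tD-leibniz f g n)) ⟩
    (mul (D f) g n + mul f (D g) n) + lam * (mul (tD f) g n + mul f (tD g) n)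
      ≈⟨ regroup _ _ _ _ _ ⟩
    (mul (D f) g n + lam * mul (tD f) g n) + (mul f (D g) n + lam * mul f (tD g) n)
      ≈⟨ +-cong (+-congˡ (mul-·ₛˡ lam (tD f) g n)) (+-congˡ (mul-·ₛʳ lam f (tD g) n)) ⟨
    (mul (D f) g n + mul (lam ·ₛ tD f) g n) + (mul f (D g) n + mul f (lam ·ₛ tD g) n)
      ≈⟨ +-cong (mul-distribʳ-+ₛ g (D f) (lam ·ₛ tD f) n) (mul-distribˡ-+ₛ f (D g) (lam ·ₛ tD g) n) ⟨
    mul (Dλ f) g n + mul f (Dλ g) n
      ∎
    where
    regroup : ∀ a b l c d → (a + b) + l * (c + d) ≈ (a + l * c) + (b + l * d)
    regroup = solve 5 (λ a b l c d → (a :+ b) :+ l :* (c :+ d) := (a :+ l :* c) :+ (b :+ l :* d)) refl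

  module _ {h : Series} (h0≈0 : h 0 ≈ 0#) (Dλh : Dλ h ≋ 1ₛ +ₛ h) where

    Dλ-pow : ∀ k → Dλ (pow h (suc k)) ≋ nat (suc k) ·ₛ (pow h k +ₛ pow h (suc k))
    Dλ-pow zero n = begin
      Dλ (pow h 1) n              ≈⟨ Dλ-cong (pow-identityʳ h) n ⟩
      Dλ h n                      ≈⟨ Dλh n ⟩
      1ₛ n + h n                  ≈⟨ +-cong (reflexive (≡.sym (pow-zero h n))) (sym (pow-identityʳ h n)) ⟩
      pow h 0 n + pow h 1 n       ≈⟨ *-identityˡ _ ⟨
      1# * (pow h 0 n + pow h 1 n) ≈⟨ *-congʳ nat-1 ⟨
      nat 1 * (pow h 0 n + pow h 1 n) ∎
    Dλ-pow (suc k) n = begin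
      Dλ (mul A h) n                                          ≈⟨ Dλ-leibniz A h n ⟩
      mul (Dλ A) h n + mul A (Dλ h) n                         ≈⟨ +-cong (mul-congˡ h (Dλ-pow k) n) (mul-congʳ A Dλh n) ⟩
      mul (nat (suc k) ·ₛ (pow h k +ₛ A)) h n + mul A (1ₛ +ₛ h) n
        ≈⟨ +-cong (trans (mul-·ₛˡ _ _ h n) (*-congˡ (mul-distribʳ-+ₛ h (pow h k) A n))) (mul-distribˡ-+ₛ A 1ₛ h n) ⟩
      nat (suc k) * (A n + B n) + (mul A 1ₛ n + B n)          ≈⟨ +-congˡ (+-congʳ (mul-identityʳ A n)) ⟩
      nat (suc k) * (A n + B n) + (A n + B n)                 ≈⟨ +-comm _ _ ⟩
      (A n + B n) + nat (suc k) * (A n + B n)                 ≈⟨ +-congʳ (*-identityˡ _) ⟨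
      1# * (A n + B n) + nat (suc k) * (A n + B n)            ≈⟨ distribʳ _ _ _ ⟨
      nat (suc (suc k)) * (A n + B n)                         ∎
      where
      A = pow h (suc k)
      B = pow h (suc (suc k))

    Dλ-compose-coeff : ∀ f n → Dλ (compose f h) n ≈ sumTo n (λ k → f (suc k) * Dλ (pow h (suc k)) n)
    Dλ-compose-coeff f n = begin
      nat (suc n) * compose f h (suc n) + lam * (nat n * compose f h n)
        ≈⟨ +-cong (*-congˡ (compose-extend f h h0≈0 {suc n} ℕₚ.≤-refl)) (*-congˡ (*-congˡ (compose-extend f h h0≈0 (ℕₚ.n≤1+n n)))) ⟩
      nat (suc n) * sumTo (suc n) (λ k → f k * pow h k (suc n)) + lam * (nat n * sumTo (suc n) (λ k → f k * pow h k n))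
        ≈⟨ +-cong (*-distribˡ-sumTo (suc n) _ _) (trans (*-congˡ (*-distribˡ-sumTo (suc n) _ _)) (*-distribˡ-sumTo (suc n) _ _)) ⟩
      sumTo (suc n) (λ k → nat (suc n) * (f k * pow h k (suc n))) + sumTo (suc n) (λ k → lam * (nat n * (f k * pow h k n)))
        ≈⟨ sumTo-distrib-+ (suc n) _ _ ⟨
      sumTo (suc n) (λ k → nat (suc n) * (f k * pow h k (suc n)) + lam * (nat n * (f k * pow h k n)))
        ≈⟨ sumTo-cong (suc n) (λ k → factor _ _ _ _ _ _) ⟩
      sumTo (suc n) (λ k → f k * Dλ (pow h k) n)
        ≈⟨ sumTo-suc n _ ⟩
      f 0 * Dλ (pow h 0) n + sumTo n (λ k → f (suc k) * Dλ (pow h (suc k)) n)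
        ≈⟨ +-congʳ (trans (*-congˡ (trans (Dλ-cong (λ m → reflexive (pow-zero h m)) n) (Dλ-1ₛ n))) (zeroʳ _)) ⟩
      0# + sumTo n (λ k → f (suc k) * Dλ (pow h (suc k)) n)
        ≈⟨ +-identityˡ _ ⟩
      sumTo n (λ k → f (suc k) * Dλ (pow h (suc k)) n)
        ∎
      where
      factor : ∀ a b x l c y → a * (b * x) + l * (c * (b * y)) ≈ b * (a * x + l * (c * y))
      factor = solve 6 (λ a b x l c y → a :* (b :* x) :+ l :* (c :* (b :* y)) := b :* (a :* x :+ l :* (c :* y))) refl

    -- The chain rule; D f +ₛ tD f is (1 + t) f′.
    Dλ-compose : ∀ f → Dλ (compose f h) ≋ compose (D f +ₛ tD f) h
    Dλ-compose f n = begin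
      Dλ (compose f h) n
        ≈⟨ Dλ-compose-coeff f n ⟩
      sumTo n (λ k → f (suc k) * Dλ (pow h (suc k)) n)
        ≈⟨ sumTo-cong n (λ k → *-congˡ (Dλ-pow k n)) ⟩
      sumTo n (λ k → f (suc k) * (nat (suc k) * (pow h k n + pow h (suc k) n)))
        ≈⟨ sumTo-cong n (λ k → expand _ _ _ _) ⟩
      sumTo n (λ k → D f k * pow h k n + tD f (suc k) * pow h (suc k) n)
        ≈⟨ sumTo-distrib-+ n _ _ ⟩
      sumTo n (λ k → D f k * pow h k n) + sumTo n (λ k → tD f (suc k) * pow h (suc k) n)
        ≈⟨ +-congˡ (sumTo-shift n (λ k → tD f k * pow h k n) (trans (*-congʳ (zeroˡ _)) (zeroˡ _))
                               (trans (*-congˡ (pow-vanishes h h0≈0 (suc n) n (ℕₚ.n<1+n n))) (zeroʳ _))) ⟩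
      sumTo n (λ k → D f k * pow h k n) + sumTo n (λ k → tD f k * pow h k n)
        ≈⟨ compose-+ₛ h (D f) (tD f) n ⟨
      compose (D f +ₛ tD f) h n
        ∎
      where
      expand : ∀ a b x y → a * (b * (x + y)) ≈ b * a * x + b * a * y
      expand = solve 4 (λ a b x y → a :* (b :* (x :+ y)) := b :* a :* x :+ b :* a :* y) refl

module DegenerateSeries {c ℓ : Level} (R : CommutativeRing c ℓ)
                        (inv : ℕ → CommutativeRing.Carrier R)
                        (nat-inv : ∀ i → CommutativeRing._≈_ R (CommutativeRing._*_ R (natR R (suc i)) (inv i))
                                                                (CommutativeRing.1# R))
                        (lam lam⁻¹ : CommutativeRing.Carrier R)
                        (lam-inv : CommutativeRing._≈_ R (CommutativeRing._*_ R lam lam⁻¹) (CommutativeRing.1# R)) where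
  open CommutativeRing R hiding (zero)
  open Degenerate R inv lam lam⁻¹
  open FormalSeries R inv lam lam⁻¹
  open RingProperties ring using (+-identityˡ-unique)
  open NaturalSolver commutativeSemiring using (solve; _:*_; _:+_; _:=_)
  open import Relation.Binary.Reasoning.Setoid setoid

  nat-!-invFact : ∀ k → nat (k !) * invFact k ≈ 1#
  nat-!-invFact zero    = trans (*-congʳ nat-1) (*-identityˡ 1#)
  nat-!-invFact (suc k) = begin
    nat (suc k ℕ.* k !) * (invFact k * inv k)            ≈⟨ *-congʳ (nat-homo-* (suc k) (k !)) ⟩
    nat (suc k) * nat (k !) * (invFact k * inv k)        ≈⟨ regroup _ _ _ _ ⟩
    (nat (suc k) * inv k) * (nat (k !) * invFact k)      ≈⟨ *-cong (nat-inv k) (nat-!-invFact k) ⟩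
    1# * 1#                                              ≈⟨ *-identityˡ 1# ⟩
    1#                                                   ∎
    where
    regroup : ∀ a b x y → a * b * (x * y) ≈ (a * y) * (b * x)
    regroup = solve 4 (λ a b x y → a :* b :* (x :* y) := (a :* y) :* (b :* x)) refl

  nat-suc-cancel : ∀ i {x} → nat (suc i) * x ≈ 0# → x ≈ 0#
  nat-suc-cancel i {x} [i+1]x≈0 = begin
    x                         ≈⟨ *-identityˡ x ⟨
    1# * x                    ≈⟨ *-congʳ (trans (*-comm _ _) (nat-inv i)) ⟨
    inv i * nat (suc i) * x   ≈⟨ *-assoc _ _ _ ⟩
    inv i * (nat (suc i) * x) ≈⟨ *-congˡ [i+1]x≈0 ⟩
    inv i * 0#                ≈⟨ zeroʳ _ ⟩
    0#                        ∎

  falling-step : ∀ x μ n → nat (suc n) * (falling x μ (suc n) * invFact (suc n))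
                          ≈ falling x μ n * invFact n * (x - nat n * μ)
  falling-step x μ n = begin
    nat (suc n) * (falling x μ n * (x - nat n * μ) * (invFact n * inv n))
      ≈⟨ regroup _ _ _ _ _ ⟩
    (nat (suc n) * inv n) * (falling x μ n * invFact n * (x - nat n * μ))
      ≈⟨ trans (*-congʳ (nat-inv n)) (*-identityˡ _) ⟩
    falling x μ n * invFact n * (x - nat n * μ)
      ∎
    where
    regroup : ∀ a p d i v → a * (p * d * (i * v)) ≈ (a * v) * (p * i * d)
    regroup = solve 5 (λ a p d i v → a :* (p :* d :* (i :* v)) := (a :* v) :* (p :* i :* d)) refl

  -- eλ n is the n-th coefficient of e_λ(t) itself (eλm1 lacks the constant term).
  eλ : Series
  eλ n = falling 1# lam n * invFact n

  Dλ-eλm1 : Dλ eλm1 ≋ 1ₛ +ₛ eλm1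
  Dλ-eλm1 n = begin
    nat (suc n) * eλm1 (suc n) + lam * (nat n * eλm1 n) ≈⟨ +-cong (falling-step 1# lam n) (*-congˡ (tD-eλm1 n)) ⟩
    eλ n * (1# - nat n * lam) + lam * (nat n * eλ n)    ≈⟨ +-congˡ (regroup _ _ _) ⟩
    eλ n * (1# - nat n * lam) + eλ n * (nat n * lam)    ≈⟨ x[1-y]+xy≈x _ _ ⟩
    eλ n                                                ≈⟨ 1ₛ+eλm1 n ⟨
    1ₛ n + eλm1 n                                       ∎
    where
    regroup : ∀ l a e → l * (a * e) ≈ e * (a * l)
    regroup = solve 3 (λ l a e → l :* (a :* e) := e :* (a :* l)) refl
    tD-eλm1 : ∀ n → nat n * eλm1 n ≈ nat n * eλ n
    tD-eλm1 zero    = trans (zeroˡ _) (sym (zeroˡ _))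
    tD-eλm1 (suc n) = refl
    1ₛ+eλm1 : ∀ n → 1ₛ n + eλm1 n ≈ eλ n
    1ₛ+eλm1 zero    = trans (+-identityʳ 1#) (sym (*-identityˡ 1#))
    1ₛ+eλm1 (suc n) = +-identityˡ _

  logλ-ode : D logλ +ₛ tD logλ ≋ 1ₛ +ₛ lam ·ₛ logλ
  logλ-ode n = begin
    nat (suc n) * logλ (suc n) + nat n * logλ n
      ≈⟨ +-cong D-logλ (tD-logλ n) ⟩
    λⁿφ n * (1# - nat n * lam⁻¹) + λⁿφ n * (nat n * lam⁻¹) ≈⟨ x[1-y]+xy≈x _ _ ⟩
    λⁿφ n                                                  ≈⟨ 1ₛ+λlogλ n ⟨
    1ₛ n + lam * logλ n                                    ∎
    where
    φ : Series
    φ n = falling 1# lam⁻¹ n * invFact n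
    λⁿφ : Series
    λⁿφ n = pw lam n * φ n
    D-logλ : nat (suc n) * logλ (suc n) ≈ λⁿφ n * (1# - nat n * lam⁻¹)
    D-logλ = begin
      nat (suc n) * (pw lam n * falling 1# lam⁻¹ (suc n) * invFact (suc n))
        ≈⟨ regroup _ _ _ _ ⟩
      pw lam n * (nat (suc n) * (falling 1# lam⁻¹ (suc n) * invFact (suc n)))
        ≈⟨ *-congˡ (falling-step 1# lam⁻¹ n) ⟩
      pw lam n * (φ n * (1# - nat n * lam⁻¹))
        ≈⟨ *-assoc _ _ _ ⟨
      λⁿφ n * (1# - nat n * lam⁻¹)
        ∎
      where
      regroup : ∀ a w p i → a * (w * p * i) ≈ w * (a * (p * i))
      regroup = solve 4 (λ a w p i → a :* (w :* p :* i) := w :* (a :* (p :* i))) refl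
    tD-logλ : ∀ n → nat n * logλ n ≈ λⁿφ n * (nat n * lam⁻¹)
    tD-logλ zero    = trans (zeroˡ _) (sym (trans (*-congˡ (zeroˡ _)) (zeroʳ _)))
    tD-logλ (suc m) = sym (trans (regroup _ _ _ _ _ _) (trans (*-congʳ lam-inv) (*-identityˡ _)))
      where
      regroup : ∀ w l p i a l′ → w * l * (p * i) * (a * l′) ≈ (l * l′) * (a * (w * p * i))
      regroup = solve 6 (λ w l p i a l′ → w :* l :* (p :* i) :* (a :* l′) := (l :* l′) :* (a :* (w :* p :* i))) refl
    1ₛ+λlogλ : ∀ n → 1ₛ n + lam * logλ n ≈ λⁿφ n
    1ₛ+λlogλ zero    = trans (+-congˡ (zeroʳ lam)) (trans (+-identityʳ 1#) (sym (trans (*-identityˡ _) (*-identityˡ 1#))))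
    1ₛ+λlogλ (suc m) = trans (+-identityˡ _) (regroup _ _ _ _)
      where
      regroup : ∀ l w p i → l * (w * p * i) ≈ w * l * (p * i)
      regroup = solve 4 (λ l w p i → l :* (w :* p :* i) := w :* l :* (p :* i)) refl

  Dλ-unique : ∀ {F} → F 0 ≈ 0# → Dλ F ≋ 1ₛ +ₛ lam ·ₛ F → F ≋ X
  Dλ-unique {F} F0≈0 DλF = F≋X
    where
    -- (j+1) F_{j+1} = F_{j+1} holds as F_1 = 1 and the higher F_{j+1} vanish; then the
    -- coefficient of tʲ⁺¹ in the equation leaves (j+2) F_{j+2} = 0.
    step : ∀ j → nat (suc j) * F (suc j) ≈ F (suc j) → F (suc (suc j)) ≈ 0#
    step j fixed = nat-suc-cancel (suc j) (+-identityˡ-unique _ (lam * F (suc j)) (begin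
      nat (suc (suc j)) * F (suc (suc j)) + lam * F (suc j) ≈⟨ +-congˡ (*-congˡ fixed) ⟨
      Dλ F (suc j)                                          ≈⟨ DλF (suc j) ⟩
      0# + lam * F (suc j)                                  ≈⟨ +-identityˡ _ ⟩
      lam * F (suc j)                                       ∎))
    vanish : ∀ j → F (suc (suc j)) ≈ 0#
    vanish zero    = step 0 (trans (*-congʳ nat-1) (*-identityˡ _))
    vanish (suc i) = step (suc i) (trans (*-congˡ (vanish i)) (trans (zeroʳ _) (sym (vanish i))))
    F≋X : F ≋ X
    F≋X zero          = F0≈0
    F≋X (suc zero)    = begin
      F 1              ≈⟨ trans (*-congʳ nat-1) (*-identityˡ _) ⟨
      nat 1 * F 1      ≈⟨ +-identityʳ _ ⟨
      nat 1 * F 1 + 0# ≈⟨ +-congˡ (trans (*-congˡ (zeroˡ _)) (zeroʳ lam)) ⟨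
      Dλ F 0           ≈⟨ DλF 0 ⟩
      1# + lam * F 0   ≈⟨ +-congˡ (trans (*-congˡ F0≈0) (zeroʳ lam)) ⟩
      1# + 0#          ≈⟨ +-identityʳ 1# ⟩
      1#               ∎
    F≋X (suc (suc j)) = vanish j

  logλ∘eλm1≋X : compose logλ eλm1 ≋ X
  logλ∘eλm1≋X = Dλ-unique (zeroˡ _) (λ n → begin
    Dλ (compose logλ eλm1) n                        ≈⟨ Dλ-compose refl Dλ-eλm1 logλ n ⟩
    compose (D logλ +ₛ tD logλ) eλm1 n               ≈⟨ compose-congˡ eλm1 logλ-ode n ⟩
    compose (1ₛ +ₛ lam ·ₛ logλ) eλm1 n               ≈⟨ compose-+ₛ eλm1 1ₛ _ n ⟩
    compose 1ₛ eλm1 n + compose (lam ·ₛ logλ) eλm1 n ≈⟨ +-cong (compose-1ₛ eλm1 n) (compose-·ₛ eλm1 lam logλ n) ⟩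
    1ₛ n + lam * compose logλ eλm1 n                 ∎)

  logλ∘logλ∘eλm1≋logλ : compose (compose logλ logλ) eλm1 ≋ logλ
  logλ∘logλ∘eλm1≋logλ n = begin
    compose (compose logλ logλ) eλm1 n ≈⟨ compose-assoc logλ logλ eλm1 refl refl n ⟩
    compose logλ (compose logλ eλm1) n ≈⟨ compose-congʳ logλ logλ∘eλm1≋X n ⟩
    compose logλ X n                   ≈⟨ compose-X logλ n ⟩
    logλ n                             ∎

  stirling-transform : ∀ g → g 0 ≈ 0# → ∀ j →
                       sum1 j (λ k → nat (k !) * g k * S2 j k) ≈ nat (j !) * compose g eλm1 j
  stirling-transform g g0≈0 j = begin
    sum1 j (λ k → nat (k !) * g k * S2 j k)         ≈⟨ sum1-cong j term ⟩
    sum1 j (λ k → nat (j !) * (g k * pow eλm1 k j)) ≈⟨ sum1≈sumTo j _ (trans (*-congˡ (trans (*-congʳ g0≈0) (zeroˡ _))) (zeroʳ _)) ⟩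
    sumTo j (λ k → nat (j !) * (g k * pow eλm1 k j)) ≈⟨ *-distribˡ-sumTo j _ _ ⟨
    nat (j !) * compose g eλm1 j                     ∎
    where
    regroup : ∀ a x b i p → a * x * (b * (i * p)) ≈ (a * i) * (b * (x * p))
    regroup = solve 5 (λ a x b i p → a :* x :* (b :* (i :* p)) := (a :* i) :* (b :* (x :* p))) refl
    term : ∀ k → nat (k !) * g k * S2 j k ≈ nat (j !) * (g k * pow eλm1 k j)
    term k = trans (regroup _ _ _ _ _) (trans (*-congʳ (nat-!-invFact k)) (*-identityˡ _))

  logλ-1 : logλ 1 ≈ 1#
  logλ-1 = trans (*-cong (trans (*-identityˡ _) (trans (*-identityˡ _) (1-0*x≈1 lam⁻¹))) inv0) (*-identityˡ 1#)
    where
    inv0 : 1# * inv 0 ≈ 1#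
    inv0 = trans (*-congʳ (sym nat-1)) (nat-inv 0)

  bel-1 : bel 1 ≈ 1#
  bel-1 = begin
    nat 1 * (logλ 0 * pow logλ 0 1 + logλ 1 * pow logλ 1 1)
      ≈⟨ *-cong nat-1 (+-cong (zeroˡ _) (*-cong logλ-1 (trans (pow-identityʳ logλ 1) logλ-1))) ⟩
    1# * (0# + 1# * 1#)
      ≈⟨ trans (*-identityˡ _) (trans (+-identityˡ _) (*-identityˡ 1#)) ⟩
    1#
      ∎

  sum1-bel-S2 : ∀ j → sum1 j (λ k → bel k * S2 j k) ≈ nat (j !) * logλ j
  sum1-bel-S2 j = trans (stirling-transform (compose logλ logλ) (zeroˡ _) j) (*-congˡ (logλ∘logλ∘eλm1≋logλ j))

  sum1-sum1-bel-S2-S2 : ∀ n → sum1 n (λ j → sum1 j (λ k → bel k * S2 j k * S2 n j)) ≈ nat (n !) * X n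
  sum1-sum1-bel-S2-S2 n = begin
    sum1 n (λ j → sum1 j (λ k → bel k * S2 j k * S2 n j)) ≈⟨ sum1-cong n (λ j → *-distribʳ-sum1 j _ _) ⟨
    sum1 n (λ j → sum1 j (λ k → bel k * S2 j k) * S2 n j) ≈⟨ sum1-cong n (λ j → *-congʳ (sum1-bel-S2 j)) ⟩
    sum1 n (λ j → nat (j !) * logλ j * S2 n j)            ≈⟨ stirling-transform logλ refl n ⟩
    nat (n !) * compose logλ eλm1 n                       ≈⟨ *-congˡ (logλ∘eλm1≋X n) ⟩
    nat (n !) * X n                                       ∎

  sum1-sum1-bel-S2-S2≈0 : ∀ n → 2 ≤ n → sum1 n (λ j → sum1 j (λ k → bel k * S2 j k * S2 n j)) ≈ 0#
  sum1-sum1-bel-S2-S2≈0 1             (s≤s ())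
  sum1-sum1-bel-S2-S2≈0 (suc (suc m)) _ = trans (sum1-sum1-bel-S2-S2 (suc (suc m))) (zeroʳ _)

theorem7 : {c ℓ : Level} (R : CommutativeRing c ℓ)
    → let open CommutativeRing R in
      (inv : ℕ → Carrier)
    → (∀ i → natR R (suc i) * inv i ≈ 1#)
    → (lam lam⁻¹ : Carrier)
    → lam * lam⁻¹ ≈ 1#
    → let open Degenerate R inv lam lam⁻¹ in
      (bel 1 ≈ 1#)
      × (∀ n → 2 ≤ n
           → sum1 n (λ j → sum1 j (λ k → bel k * S2 j k * S2 n j)) ≈ 0#)
theorem7 R inv nat-inv lam lam⁻¹ lam-inv = bel-1 , sum1-sum1-bel-S2-S2≈0
  where open DegenerateSeries R inv nat-inv lam lam⁻¹ lam-inv
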